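{- For every $w\in\mathfrak{W}_n$, $w\cdot\mathbf{h}=\mathbf{r}_n-\mathbf{h}$ if $|\mathrm{Neg}(w)|$ is odd and $w\cdot\mathbf{h}=\mathbf{h}$ if $|\mathrm{Neg}(w)|$ is even. Moreover, $w\cdot(\mathbf{r}_n-2\mathbf{h})=2\mathbf{h}-\mathbf{r}_n$ if $|\mathrm{Neg}(w)|$ is odd and $w\cdot(\mathbf{r}_n-2\mathbf{h})=\mathbf{r}_n-2\mathbf{h}$ if $|\mathrm{Neg}(w)|$ is even.
   Context: Let $n\ge 2$, $[n]=\{1,\dots,n\}$, $[\bar n]=\{\pm1,\dots,\pm n\}$, $\bar i=-i$. $\mathfrak{W}_n$ is the group of bijections $w$ of $[\bar n]$ with $w(\bar i)=\overline{w(i)}$. $\mathrm{Neg}(w)=\{w(i):i\in[n],\ w(i)<0\}$. In $\mathbb{C}[x_1,\dots,x_n]$ set $x_{\bar k}:=-x_k$. $\mathfrak{W}_n$ acts on polynomials by $(wf)(x_1,\dots,x_n)=f(x_{w(1)},\dots,x_{w(n)})$ and on functions $\rho:\mathfrak{W}_n\to\mathbb{C}[x_1,\dots,x_n]$ by $(w\cdot\rho)(v)=w(\rho(w^{ -1}v))$. $\mathbf{r}_n(w)=x_{w(n)}$; $\mathbf{h}(w)=x_{w(n)}$ if $|\mathrm{Neg}(w)|$ is odd and $0$ otherwise. -}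

module Defs where

open import Data.Bool using (Bool; true; false; not; if_then_else_)
open import Data.Bool.Properties using (not-involutive)
open import Data.Nat using (ℕ; suc; _%_)
open import Data.Fin using (Fin; fromℕ)
open import Data.Integer using (ℤ; +_) renaming (_+_ to _+ℤ_; _*_ to _*ℤ_; -_ to -ℤ_)
open import Data.Product using (Σ; _×_; _,_; proj₁; proj₂)
open import Data.List using (List; length; filterᵇ; map)
open import Data.List.Base using (allFin)
open import Function using (_∘_; _↔_; Inverse)
open import Function.Properties.Inverse using (↔-sym; ↔-trans)
open import Relation.Binary.PropositionalEquality
  using (_≡_; refl; sym; trans; cong)

-- The signed set [n̄] = {±1,…,±n}.
-- A signed index is a pair (b , i) : Bool × Fin n, standing for the
-- integer -(i+1) if b ≡ true and +(i+1) if b ≡ false.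

SIdx : ℕ → Set
SIdx n = Bool × Fin n

bar : ∀ {n} → SIdx n → SIdx n
bar (b , i) = (not b , i)

isNeg : ∀ {n} → SIdx n → Bool
isNeg = proj₁

pos : ∀ {n} → Fin n → SIdx n
pos i = (false , i)

record W (n : ℕ) : Set where
  field
    perm   : SIdx n ↔ SIdx n
    barEqv : ∀ s → Inverse.to perm (bar s) ≡ bar (Inverse.to perm s)

open W public

app : ∀ {n} → W n → SIdx n → SIdx n
app w = Inverse.to (perm w)

winv : ∀ {n} → W n → W n
winv {n} w = record { perm = ↔-sym (perm w) ; barEqv = pf }
  where
  f = Inverse.to (perm w)
  g = Inverse.from (perm w)
  pf : ∀ s → g (bar s) ≡ bar (g s)
  pf s = Inverse.inverseʳ (perm w) (sym eq)
    where
    eq : f (bar (g s)) ≡ bar s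
    eq = trans (barEqv w (g s)) (cong bar (Inverse.inverseˡ (perm w) refl))

-- product v w (first apply w, then v), i.e. (v w)(s) = v (w s)
wmul : ∀ {n} → W n → W n → W n
wmul v w = record
  { perm   = ↔-trans (perm w) (perm v)
  ; barEqv = λ s → trans (cong (app v) (barEqv w s)) (barEqv v (app w s)) }

-- Neg(w) = { w(i) : i ∈ [n], w(i) < 0 }  (as a list, without repetition
-- since w is injective) and its cardinality
Neg : ∀ {n} → W n → List (SIdx n)
Neg {n} w = filterᵇ isNeg (map (app w ∘ pos) (allFin n))

negCard : ∀ {n} → W n → ℕ
negCard w = length (Neg w)

-- Polynomials in x₁,…,xₙ (integer coefficients), as expressions,
-- compared by equality of the polynomial functions ℤⁿ → ℤ (which over
-- the infinite integral domain ℤ is equality of polynomials).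

data Poly (n : ℕ) : Set where
  var  : Fin n → Poly n
  con  : ℤ → Poly n
  _⊕_  : Poly n → Poly n → Poly n
  _⊗_  : Poly n → Poly n → Poly n
  ⊖_   : Poly n → Poly n

infixl 6 _⊕_
infixl 7 _⊗_

_⊝_ : ∀ {n} → Poly n → Poly n → Poly n
p ⊝ q = p ⊕ (⊖ q)

eval : ∀ {n} → (Fin n → ℤ) → Poly n → ℤ
eval a (var i) = a i
eval a (con c) = c
eval a (p ⊕ q) = eval a p +ℤ eval a q
eval a (p ⊗ q) = eval a p *ℤ eval a q
eval a (⊖ p)   = -ℤ eval a p

_≈P_ : ∀ {n} → Poly n → Poly n → Set
p ≈P q = ∀ a → eval a p ≡ eval a q

x : ∀ {n} → SIdx n → Poly n
x (false , k) = var k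
x (true  , k) = ⊖ var k

subst : ∀ {n} → (Fin n → Poly n) → Poly n → Poly n
subst σ (var i) = σ i
subst σ (con c) = con c
subst σ (p ⊕ q) = subst σ p ⊕ subst σ q
subst σ (p ⊗ q) = subst σ p ⊗ subst σ q
subst σ (⊖ p)   = ⊖ subst σ p

actP : ∀ {n} → W n → Poly n → Poly n
actP w f = subst (λ i → x (app w (pos i))) f

Fun : ℕ → Set
Fun n = W n → Poly n

actF : ∀ {n} → W n → Fun n → Fun n
actF w ρ v = actP w (ρ (wmul (winv w) v))

_≈F_ : ∀ {n} → Fun n → Fun n → Set
ρ ≈F τ = ∀ v → ρ v ≈P τ v

_⊝F_ : ∀ {n} → Fun n → Fun n → Fun n
(ρ ⊝F τ) v = ρ v ⊝ τ v

_·F_ : ∀ {n} → ℤ → Fun n → Fun n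
(c ·F ρ) v = con c ⊗ ρ v

Odd Even : ℕ → Set
Odd  k = k % 2 ≡ 1
Even k = k % 2 ≡ 0

-- r_n(w) = x_{w(n)} ; here n = suc m and the index n is fromℕ m.
rₙ : ∀ {m} → Fun (suc m)
rₙ {m} w = x (app w (pos (fromℕ m)))

h : ∀ {m} → Fun (suc m)
h w = if negCard w % 2 Data.Nat.≡ᵇ 1 then rₙ w else con (+ 0)

-- The number of negative letters of w ∈ 𝔚ₙ, counted mod 2, is the sum over i of
-- the sign bits of w(i); since (vu)(i) has sign bit (sign of u(i)) + (sign of
-- v(|u(i)|)) and |u| permutes [n], this parity is a homomorphism 𝔚ₙ → ℤ/2.
-- Hence (w·h)(v) = w(h(w⁻¹v)) equals x_{v(n)} exactly when |Neg(v)| + |Neg(w)| is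
-- odd, because w(x_{w⁻¹v(n)}) = x_{v(n)}. For odd |Neg(w)| this is r_n − h, for
-- even |Neg(w)| it is h, and the statement about r_n − 2h follows by linearity.
module Submission where

open import Defs
open import Algebra.Bundles using (CommutativeRing)
import Algebra.Properties.CommutativeMonoid.Sum as CommutativeMonoidSum
open import Data.Bool using (Bool; true; false; not; _xor_; if_then_else_)
open import Data.Bool.Properties using (xor-∧-commutativeRing; xor-identityʳ)
open import Data.Fin as Fin using (Fin)
open import Data.Fin.Permutation using (Permutation; permutation)
open import Data.Integer using (+_; _-_; _*_; -_)
open import Data.Integer.Properties using (neg-involutive; +-inverseʳ; +-identityʳ)
open import Data.Integer.Solver using (module +-*-Solver)
open import Data.List using (length; filterᵇ; tabulate)
open import Data.List.Properties using (map-tabulate)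
open import Data.Nat as ℕ using (ℕ; zero; suc; _%_; _≡ᵇ_)
open import Data.Nat.DivMod using ([m+n]%n≡m%n)
open import Data.Nat.Properties using (+-comm)
open import Data.Product using (_×_; _,_; proj₂)
open import Function using (_∘_; id; Inverse)
open import Relation.Binary.PropositionalEquality
  using (_≡_; refl; sym; trans; cong; cong₂; module ≡-Reasoning)

open ≡-Reasoning

isOdd : ℕ → Bool
isOdd zero          = false
isOdd (suc zero)    = true
isOdd (suc (suc k)) = isOdd k

isOdd-suc : ∀ k → isOdd (suc k) ≡ not (isOdd k)
isOdd-suc zero          = refl
isOdd-suc (suc zero)    = refl
isOdd-suc (suc (suc k)) = isOdd-suc k

%2≡ᵇ1≡isOdd : ∀ k → (k % 2 ≡ᵇ 1) ≡ isOdd k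
%2≡ᵇ1≡isOdd zero          = refl
%2≡ᵇ1≡isOdd (suc zero)    = refl
%2≡ᵇ1≡isOdd (suc (suc k)) = begin
  suc (suc k) % 2 ≡ᵇ 1 ≡⟨ cong (λ j → j % 2 ≡ᵇ 1) (+-comm 2 k) ⟩
  (k ℕ.+ 2) % 2 ≡ᵇ 1   ≡⟨ cong (_≡ᵇ 1) ([m+n]%n≡m%n k 2) ⟩
  k % 2 ≡ᵇ 1           ≡⟨ %2≡ᵇ1≡isOdd k ⟩
  isOdd k              ∎

Odd⇒isOdd : ∀ k → Odd k → isOdd k ≡ true
Odd⇒isOdd k odd = trans (sym (%2≡ᵇ1≡isOdd k)) (cong (_≡ᵇ 1) odd)

Even⇒¬isOdd : ∀ k → Even k → isOdd k ≡ false
Even⇒¬isOdd k even = trans (sym (%2≡ᵇ1≡isOdd k)) (cong (_≡ᵇ 1) even)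

xor-cancelʳ : ∀ a b → (a xor b) xor b ≡ a
xor-cancelʳ false false = refl
xor-cancelʳ false true  = refl
xor-cancelʳ true  false = refl
xor-cancelʳ true  true  = refl

open CommutativeMonoidSum (CommutativeRing.+-commutativeMonoid xor-∧-commutativeRing)
  using (sum; sum-permute; ∑-distrib-+; sum-cong-≗)

isOdd-length-filter : ∀ {A : Set} (p : A → Bool) {k} (f : Fin k → A) →
  isOdd (length (filterᵇ p (tabulate f))) ≡ sum (p ∘ f)
isOdd-length-filter p {zero}  f = refl
isOdd-length-filter p {suc k} f with p (f Fin.zero)
... | true  = trans (isOdd-suc (length (filterᵇ p (tabulate (f ∘ Fin.suc)))))
                    (cong not (isOdd-length-filter p (f ∘ Fin.suc)))
... | false = isOdd-length-filter p (f ∘ Fin.suc)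

-- ℤ/2 is modelled by (Bool, xor); isNeg is the sign bit.
negParity : ∀ {n} → W n → Bool
negParity w = sum (λ i → isNeg (app w (pos i)))

isOdd-negCard : ∀ {n} (w : W n) → isOdd (negCard w) ≡ negParity w
isOdd-negCard w = trans
  (cong (isOdd ∘ length ∘ filterᵇ isNeg) (map-tabulate id (app w ∘ pos)))
  (isOdd-length-filter isNeg (app w ∘ pos))

unsigned : ∀ {n} → W n → Fin n → Fin n
unsigned w i = proj₂ (app w (pos i))

unsigned-inverse : ∀ {n} (w : W n) j → unsigned w (unsigned (winv w) j) ≡ j
unsigned-inverse w j
  with Inverse.from (perm w) (pos j) | Inverse.inverseˡ (perm w) {pos j} refl
... | false , i | w[i]≡j = cong proj₂ w[i]≡j
... | true  , i | w[i]≡j = cong proj₂ (trans (barEqv w (true , i)) (cong bar w[i]≡j))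

unsignedPerm : ∀ {n} → W n → Permutation n n
unsignedPerm w =
  permutation (unsigned w) (unsigned (winv w)) (unsigned-inverse w) (unsigned-inverse (winv w))

isNeg-app : ∀ {n} (v : W n) s → isNeg (app v s) ≡ isNeg s xor isNeg (app v (pos (proj₂ s)))
isNeg-app v (false , j) = refl
isNeg-app v (true  , j) = cong isNeg (barEqv v (pos j))

negParity-wmul : ∀ {n} (v u : W n) → negParity (wmul v u) ≡ negParity u xor negParity v
negParity-wmul v u = begin
  negParity (wmul v u)
    ≡⟨ sum-cong-≗ (λ i → isNeg-app v (app u (pos i))) ⟩
  sum (λ i → isNeg (app u (pos i)) xor isNeg (app v (pos (unsigned u i))))
    ≡⟨ ∑-distrib-+ (λ i → isNeg (app u (pos i))) (λ i → isNeg (app v (pos (unsigned u i)))) ⟩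
  negParity u xor sum (λ i → isNeg (app v (pos (unsigned u i))))
    ≡⟨ cong (negParity u xor_) (sym (sum-permute (λ j → isNeg (app v (pos j))) (unsignedPerm u))) ⟩
  negParity u xor negParity v
    ∎

negParity-winv-wmul : ∀ {n} (w v : W n) →
  negParity (wmul (winv w) v) ≡ negParity v xor negParity w
negParity-winv-wmul w v = begin
  negParity u                                   ≡⟨ sym (xor-cancelʳ (negParity u) (negParity w)) ⟩
  (negParity u xor negParity w) xor negParity w ≡⟨ cong (_xor negParity w) (sym (negParity-wmul w u)) ⟩
  negParity (wmul w u) xor negParity w          ≡⟨ cong (_xor negParity w) (sum-cong-≗ w-cancels-winv) ⟩
  negParity v xor negParity w                   ∎
  where
  u = wmul (winv w) v
  w-cancels-winv : ∀ i → isNeg (app (wmul w u) (pos i)) ≡ isNeg (app v (pos i))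
  w-cancels-winv i = cong isNeg (Inverse.inverseˡ (perm w) refl)

Odd⇒negParity : ∀ {n} (w : W n) → Odd (negCard w) → negParity w ≡ true
Odd⇒negParity w odd = trans (sym (isOdd-negCard w)) (Odd⇒isOdd (negCard w) odd)

Even⇒¬negParity : ∀ {n} (w : W n) → Even (negCard w) → negParity w ≡ false
Even⇒¬negParity w even = trans (sym (isOdd-negCard w)) (Even⇒¬isOdd (negCard w) even)

eval-x-bar : ∀ {n} a (s : SIdx n) → eval a (x (bar s)) ≡ - eval a (x s)
eval-x-bar a (false , k) = refl
eval-x-bar a (true  , k) = sym (neg-involutive (a k))

eval-actP-x : ∀ {n} (w : W n) a s → eval a (actP w (x s)) ≡ eval a (x (app w s))
eval-actP-x w a (false , k) = refl
eval-actP-x w a (true  , k) = begin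
  - eval a (x (app w (pos k)))      ≡⟨ sym (eval-x-bar a (app w (pos k))) ⟩
  eval a (x (bar (app w (pos k))))  ≡⟨ cong (eval a ∘ x) (sym (barEqv w (pos k))) ⟩
  eval a (x (app w (true , k)))     ∎

actF-rₙ : ∀ {m} (w : W (suc m)) → actF w rₙ ≈F rₙ
actF-rₙ w v a = trans (eval-actP-x w a _) (cong (eval a ∘ x) (Inverse.inverseˡ (perm w) refl))

infix 30 _onlyIf_

_onlyIf_ : ∀ {n} → Poly n → Bool → Poly n
p onlyIf b = if b then p else con (+ 0)

h-gated : ∀ {m} (v : W (suc m)) → h v ≡ rₙ v onlyIf negParity v
h-gated v = cong (rₙ v onlyIf_) (trans (%2≡ᵇ1≡isOdd (negCard v)) (isOdd-negCard v))

actF-h : ∀ {m} (w v : W (suc m)) → actF w h v ≈P rₙ v onlyIf (negParity v xor negParity w)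
actF-h w v a = begin
  eval a (actP w (h u))                              ≡⟨ cong (eval a ∘ actP w) (h-gated u) ⟩
  eval a (actP w (rₙ u onlyIf negParity u))          ≡⟨ act-gated (negParity u) ⟩
  eval a (rₙ v onlyIf negParity u)                   ≡⟨ cong (eval a ∘ (rₙ v onlyIf_)) (negParity-winv-wmul w v) ⟩
  eval a (rₙ v onlyIf (negParity v xor negParity w)) ∎
  where
  u = wmul (winv w) v
  act-gated : ∀ b → eval a (actP w (rₙ u onlyIf b)) ≡ eval a (rₙ v onlyIf b)
  act-gated true  = actF-rₙ w v a
  act-gated false = refl

actF-h-odd : ∀ {m} (w : W (suc m)) → negParity w ≡ true → actF w h ≈F (rₙ ⊝F h)
actF-h-odd w odd v a = begin
  eval a (actF w h v)                                ≡⟨ actF-h w v a ⟩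
  eval a (rₙ v onlyIf (negParity v xor negParity w)) ≡⟨ cong (λ b → eval a (rₙ v onlyIf (negParity v xor b))) odd ⟩
  eval a (rₙ v onlyIf (negParity v xor true))        ≡⟨ complement (negParity v) ⟩
  eval a (rₙ v ⊝ rₙ v onlyIf negParity v)            ≡⟨ cong (λ p → eval a (rₙ v ⊝ p)) (sym (h-gated v)) ⟩
  eval a (rₙ v ⊝ h v)                                ∎
  where
  complement : ∀ b → eval a (rₙ v onlyIf (b xor true)) ≡ eval a (rₙ v ⊝ rₙ v onlyIf b)
  complement true  = sym (+-inverseʳ (eval a (rₙ v)))
  complement false = sym (+-identityʳ (eval a (rₙ v)))

actF-h-even : ∀ {m} (w : W (suc m)) → negParity w ≡ false → actF w h ≈F h
actF-h-even w even v a = begin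
  eval a (actF w h v)                                ≡⟨ actF-h w v a ⟩
  eval a (rₙ v onlyIf (negParity v xor negParity w)) ≡⟨ cong (eval a ∘ (rₙ v onlyIf_)) parity≡ ⟩
  eval a (rₙ v onlyIf negParity v)                   ≡⟨ cong (eval a) (sym (h-gated v)) ⟩
  eval a (h v)                                       ∎
  where
  parity≡ : negParity v xor negParity w ≡ negParity v
  parity≡ = trans (cong (negParity v xor_) even) (xor-identityʳ (negParity v))

actF-rₙ-2h : ∀ {m} (w : W (suc m)) {τ : Fun (suc m)} → actF w h ≈F τ →
  actF w (rₙ ⊝F ((+ 2) ·F h)) ≈F (rₙ ⊝F ((+ 2) ·F τ))
actF-rₙ-2h w w·h≈τ v a = cong₂ (λ r t → r - + 2 * t) (actF-rₙ w v a) (w·h≈τ v a)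

r-2[r-t]≡2t-r : ∀ r t → r - + 2 * (r - t) ≡ + 2 * t - r
r-2[r-t]≡2t-r = solve 2 (λ r t → r :- con (+ 2) :* (r :- t) := con (+ 2) :* t :- r) refl
  where open +-*-Solver

lemma6p7 : (m : ℕ) → (w : W (suc (suc m))) →
    ((Odd (negCard w) → actF w h ≈F (rₙ ⊝F h)) ×
     (Even (negCard w) → actF w h ≈F h)) ×
    ((Odd (negCard w) → actF w (rₙ ⊝F ((+ 2) ·F h)) ≈F (((+ 2) ·F h) ⊝F rₙ)) ×
     (Even (negCard w) → actF w (rₙ ⊝F ((+ 2) ·F h)) ≈F (rₙ ⊝F ((+ 2) ·F h))))
lemma6p7 m w = (w·h-odd , w·h-even) , (w·[r-2h]-odd , actF-rₙ-2h w {h} ∘ w·h-even)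
  where
  w·h-odd : Odd (negCard w) → actF w h ≈F (rₙ ⊝F h)
  w·h-odd = actF-h-odd w ∘ Odd⇒negParity w

  w·h-even : Even (negCard w) → actF w h ≈F h
  w·h-even = actF-h-even w ∘ Even⇒¬negParity w

  w·[r-2h]-odd : Odd (negCard w) → actF w (rₙ ⊝F ((+ 2) ·F h)) ≈F (((+ 2) ·F h) ⊝F rₙ)
  w·[r-2h]-odd odd v a =
    trans (actF-rₙ-2h w {rₙ ⊝F h} (w·h-odd odd) v a) (r-2[r-t]≡2t-r (eval a (rₙ v)) (eval a (h v)))
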